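{- For every agent $a$, every propositional formula $\varphi$ (built from propositional variables with $\neg$ and $\wedge$ only) and every $\psi\in\mathcal L_\forall$, the following are derivable in $\mathbf{RML}$: (1) $\forall_a\varphi\leftrightarrow\varphi$; (2) $\exists_a\varphi\leftrightarrow\varphi$; (3) $(\varphi\wedge\exists_a\psi)\leftrightarrow\exists_a(\varphi\wedge\psi)$.
   Context: Fix a finite set $A$ of agents and a countable set $P$ of propositional variables. $\mathcal L_\forall$: $\varphi::=p\mid\neg\varphi\mid(\varphi\wedge\varphi)\mid\Box_a\varphi\mid\forall_a\varphi$; abbreviations $\vee,\to,\leftrightarrow,\top,\bot$ usual, $\Diamond_a\varphi:=\neg\Box_a\neg\varphi$, $\exists_a\varphi:=\neg\forall_a\neg\varphi$, and for finite $\Phi$, $\nabla_a\Phi:=\Box_a\bigvee\Phi\wedge\bigwedge_{\chi\in\Phi}\Diamond_a\chi$ (empty disjunction $\bot$, empty conjunction $\top$). The axiomatization $\mathbf{RML}$ consists of all instances of: propositional tautologies; $\Box_a(\varphi\to\psi)\to(\Box_a\varphi\to\Box_a\psi)$; $\forall_a(\varphi\to\psi)\to(\forall_a\varphi\to\forall_a\psi)$; $\forall_ap\leftrightarrow p$ and $\forall_a\neg p\leftrightarrow\neg p$ for $p\in P$; $\exists_a\nabla_a\Phi\leftrightarrow\bigwedge_{\chi\in\Phi}\Diamond_a\exists_a\chi$; $\exists_a\nabla_b\Phi\leftrightarrow\nabla_b\{\exists_a\chi\mid\chi\in\Phi\}$ for $a\neq b$; $\exists_a\bigwedge_{b\in B}\nabla_b\Phi^b\leftrightarrow\bigwedge_{b\in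 B}\exists_a\nabla_b\Phi^b$ for $B\subseteq A$; with the rules modus ponens, from $\varphi$ infer $\Box_a\varphi$, and from $\varphi$ infer $\forall_a\varphi$. -}

module Defs where

open import Data.Nat using (ℕ)
open import Data.Fin using (Fin)
open import Data.Bool using (Bool; true; false; not; _∧_; T?)
open import Data.List using (List; []; _∷_; foldr; map; filter)
open import Data.List.Membership.Propositional using (_∈_)
open import Data.Product using (_×_)
open import Relation.Binary.PropositionalEquality using (_≡_; _≢_)
open import Relation.Nullary using (¬_)
import Data.List as L
import Data.Fin.Base as F

module Logic (n : ℕ) where

  Agent : Set
  Agent = Fin n

  infix 8 ¬'_
  infixr 6 _∧'_
  infixr 5 _∨'_
  infixr 4 _⇒_
  infix 3 _⇔_
  data Form : Set where
    var  : ℕ → Form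
    ¬'_  : Form → Form
    _∧'_ : Form → Form → Form
    □    : Agent → Form → Form
    ∀'   : Agent → Form → Form

  _∨'_ : Form → Form → Form
  φ ∨' ψ = ¬' (¬' φ ∧' ¬' ψ)

  _⇒_ : Form → Form → Form
  φ ⇒ ψ = ¬' (φ ∧' ¬' ψ)

  _⇔_ : Form → Form → Form
  φ ⇔ ψ = (φ ⇒ ψ) ∧' (ψ ⇒ φ)

  ⊤' : Form
  ⊤' = ¬' (var 0 ∧' ¬' var 0)

  ⊥' : Form
  ⊥' = ¬' ⊤'

  ◇ : Agent → Form → Form
  ◇ a φ = ¬' □ a (¬' φ)

  ∃' : Agent → Form → Form
  ∃' a φ = ¬' ∀' a (¬' φ)

  ⋀ : List Form → Form
  ⋀ = foldr _∧'_ ⊤'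

  ⋁ : List Form → Form
  ⋁ = foldr _∨'_ ⊥'

  ∇ : Agent → List Form → Form
  ∇ a Φ = □ a (⋁ Φ) ∧' ⋀ (map (◇ a) Φ)

  -- propositional tautology instances: true under every assignment of truth
  -- values to the propositional atoms, i.e. variables and □/∀ subformulas
  evalP : (Form → Bool) → Form → Bool
  evalP v (var p)    = v (var p)
  evalP v (¬' φ)     = not (evalP v φ)
  evalP v (φ ∧' ψ)   = evalP v φ ∧ evalP v ψ
  evalP v (□ a φ)    = v (□ a φ)
  evalP v (∀' a φ)   = v (∀' a φ)

  Tautology : Form → Set
  Tautology φ = (v : Form → Bool) → evalP v φ ≡ true

  ⋀∇ : (Agent → Bool) → (Agent → List Form) → Form
  ⋀∇ B Φ = ⋀ (map (λ b → ∇ b (Φ b)) (filter (λ b → T? (B b)) (L.allFin n)))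

  ⋀∃∇ : Agent → (Agent → Bool) → (Agent → List Form) → Form
  ⋀∃∇ a B Φ = ⋀ (map (λ b → ∃' a (∇ b (Φ b))) (filter (λ b → T? (B b)) (L.allFin n)))

  data ⊢_ : Form → Set where
    taut   : ∀ {φ} → Tautology φ → ⊢ φ
    K□     : ∀ a φ ψ → ⊢ (□ a (φ ⇒ ψ) ⇒ (□ a φ ⇒ □ a ψ))
    K∀     : ∀ a φ ψ → ⊢ (∀' a (φ ⇒ ψ) ⇒ (∀' a φ ⇒ ∀' a ψ))
    AP     : ∀ a p → ⊢ (∀' a (var p) ⇔ var p)
    ANP    : ∀ a p → ⊢ (∀' a (¬' var p) ⇔ ¬' var p)
    RK     : ∀ a Φ → ⊢ (∃' a (∇ a Φ) ⇔ ⋀ (map (λ χ → ◇ a (∃' a χ)) Φ))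
    RComm  : ∀ a b Φ → a ≢ b → ⊢ (∃' a (∇ b Φ) ⇔ ∇ b (map (∃' a) Φ))
    RDist  : ∀ a B Φ → ⊢ (∃' a (⋀∇ B Φ) ⇔ ⋀∃∇ a B Φ)
    MP     : ∀ {φ ψ} → ⊢ (φ ⇒ ψ) → ⊢ φ → ⊢ ψ
    Nec□   : ∀ {φ} a → ⊢ φ → ⊢ □ a φ
    Nec∀   : ∀ {φ} a → ⊢ φ → ⊢ ∀' a φ

  data IsProp : Form → Set where
    var : ∀ p → IsProp (var p)
    neg : ∀ {φ} → IsProp φ → IsProp (¬' φ)
    con : ∀ {φ ψ} → IsProp φ → IsProp ψ → IsProp (φ ∧' ψ)

-- Over a propositional formula the modality ∀ₐ is trivial: the axioms ∀ₐp ↔ p and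
-- ∀ₐ¬p ↔ ¬p propagate through ¬ and ∧ (by a simultaneous induction) to φ → ∀ₐφ and
-- ¬φ → ∀ₐ¬φ, and they also make ∀ₐ serial (¬∀ₐ⊥), which gives the converse ∀ₐφ → φ.
-- Dualising yields ∃ₐφ ↔ φ, and the commutation with ∃ₐ is the normal-modal-logic
-- fact ∀ₐφ ∧ ∃ₐψ → ∃ₐ(φ ∧ ψ) together with monotonicity of ∃ₐ.
module Submission where

open import Defs
open import Data.Nat using (ℕ; zero; suc)
open import Data.Fin using (Fin; zero; suc)
open import Data.Bool using (Bool; true; false; not; _∧_; T)
open import Data.Bool.Properties using (T-∧; T-≡)
open import Data.Vec using (Vec; []; _∷_; lookup; map)
open import Data.Vec.Properties using (lookup-map)
open import Data.Product using (_×_; _,_; proj₁; proj₂)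
open import Function using (_∘_)
open import Function.Bundles using (Equivalence)
open import Relation.Binary.PropositionalEquality using (_≡_; sym; trans; cong; cong₂)

open Equivalence using (to)

module Derivations (n : ℕ) where
  open Logic n

  private variable
    k : ℕ
    φ ψ χ φ′ ψ′ : Form

  -- Propositional schemata in k metavariables; a truth-table check on a schema
  -- certifies every instance as a tautology.

  infix 8 ‵¬_
  infixr 6 _‵∧_
  infixr 4 _‵⇒_
  data Schema (k : ℕ) : Set where
    ‵_   : Fin k → Schema k
    ‵¬_  : Schema k → Schema k
    _‵∧_ : Schema k → Schema k → Schema k

  P : Schema (suc k)
  P = ‵ zero

  Q : Schema (suc (suc k))
  Q = ‵ suc zero

  R : Schema (suc (suc (suc k)))
  R = ‵ suc (suc zero)

  _‵⇒_ : Schema k → Schema k → Schema k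
  S ‵⇒ S′ = ‵¬ (S ‵∧ ‵¬ S′)

  ⟦_⟧ : Schema k → Vec Form k → Form
  ⟦ ‵ i ⟧     σ = lookup σ i
  ⟦ ‵¬ S ⟧    σ = ¬' ⟦ S ⟧ σ
  ⟦ S ‵∧ S′ ⟧ σ = ⟦ S ⟧ σ ∧' ⟦ S′ ⟧ σ

  truth : Vec Bool k → Schema k → Bool
  truth ρ (‵ i)     = lookup ρ i
  truth ρ (‵¬ S)    = not (truth ρ S)
  truth ρ (S ‵∧ S′) = truth ρ S ∧ truth ρ S′

  evalP-⟦⟧ : ∀ v (S : Schema k) σ → evalP v (⟦ S ⟧ σ) ≡ truth (map (evalP v) σ) S
  evalP-⟦⟧ v (‵ i)     σ = sym (lookup-map i (evalP v) σ)
  evalP-⟦⟧ v (‵¬ S)    σ = cong not (evalP-⟦⟧ v S σ)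
  evalP-⟦⟧ v (S ‵∧ S′) σ = cong₂ _∧_ (evalP-⟦⟧ v S σ) (evalP-⟦⟧ v S′ σ)

  allAssignments : ∀ k → (Vec Bool k → Bool) → Bool
  allAssignments zero    f = f []
  allAssignments (suc k) f =
    allAssignments k (f ∘ (true ∷_)) ∧ allAssignments k (f ∘ (false ∷_))

  allAssignments-sound : ∀ k f → T (allAssignments k f) → ∀ ρ → T (f ρ)
  allAssignments-sound zero    f t []          = t
  allAssignments-sound (suc k) f t (true ∷ ρ)  =
    allAssignments-sound k _ (proj₁ (to T-∧ t)) ρ
  allAssignments-sound (suc k) f t (false ∷ ρ) =
    allAssignments-sound k _ (proj₂ (to T-∧ t)) ρ

  Valid : Schema k → Set
  Valid {k} S = T (allAssignments k (λ ρ → truth ρ S))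

  -- For a concrete schema Valid S normalises to ⊤, so the implicit proof is found by eta.
  tautology : (S : Schema k) {valid : Valid S} (σ : Vec Form k) → ⊢ ⟦ S ⟧ σ
  tautology {k} S {valid} σ = taut λ v →
    trans (evalP-⟦⟧ v S σ)
          (to T-≡ (allAssignments-sound k (λ ρ → truth ρ S) valid (map (evalP v) σ)))

  ⇒-refl : ⊢ (φ ⇒ φ)
  ⇒-refl {φ} = tautology (P ‵⇒ P) (φ ∷ [])

  ⇒-trans : ⊢ (φ ⇒ ψ) → ⊢ (ψ ⇒ χ) → ⊢ (φ ⇒ χ)
  ⇒-trans {φ} {ψ} {χ} = MP ∘ MP (tautology
    ((P ‵⇒ Q) ‵⇒ (Q ‵⇒ R) ‵⇒ P ‵⇒ R) (φ ∷ ψ ∷ χ ∷ []))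

  ∧-elimˡ : ⊢ (φ ∧' ψ ⇒ φ)
  ∧-elimˡ {φ} {ψ} = tautology (P ‵∧ Q ‵⇒ P) (φ ∷ ψ ∷ [])

  ∧-elimʳ : ⊢ (φ ∧' ψ ⇒ ψ)
  ∧-elimʳ {φ} {ψ} = tautology (P ‵∧ Q ‵⇒ Q) (φ ∷ ψ ∷ [])

  ⇒-∧-intro : ⊢ (φ ⇒ ψ) → ⊢ (φ ⇒ χ) → ⊢ (φ ⇒ ψ ∧' χ)
  ⇒-∧-intro {φ} {ψ} {χ} = MP ∘ MP (tautology
    ((P ‵⇒ Q) ‵⇒ (P ‵⇒ R) ‵⇒ P ‵⇒ Q ‵∧ R) (φ ∷ ψ ∷ χ ∷ []))

  ∧-mono : ⊢ (φ ⇒ φ′) → ⊢ (ψ ⇒ ψ′) → ⊢ (φ ∧' ψ ⇒ φ′ ∧' ψ′)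
  ∧-mono p q = ⇒-∧-intro (⇒-trans ∧-elimˡ p) (⇒-trans ∧-elimʳ q)

  ⇒-uncurry : ⊢ (φ ⇒ ψ ⇒ χ) → ⊢ (φ ∧' ψ ⇒ χ)
  ⇒-uncurry {φ} {ψ} {χ} = MP (tautology
    ((P ‵⇒ Q ‵⇒ R) ‵⇒ P ‵∧ Q ‵⇒ R) (φ ∷ ψ ∷ χ ∷ []))

  ⇒-contrapose : ⊢ (φ ⇒ ψ) → ⊢ (¬' ψ ⇒ ¬' φ)
  ⇒-contrapose {φ} {ψ} = MP (tautology
    ((P ‵⇒ Q) ‵⇒ ‵¬ Q ‵⇒ ‵¬ P) (φ ∷ ψ ∷ []))

  ¬¬-elim : ⊢ (¬' ¬' φ ⇒ φ)
  ¬¬-elim {φ} = tautology (‵¬ ‵¬ P ‵⇒ P) (φ ∷ [])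

  ¬¬-intro : ⊢ (φ ⇒ ¬' ¬' φ)
  ¬¬-intro {φ} = tautology (P ‵⇒ ‵¬ ‵¬ P) (φ ∷ [])

  ¬∧-cases : ⊢ (¬' φ ⇒ χ) → ⊢ (¬' ψ ⇒ χ) → ⊢ (¬' (φ ∧' ψ) ⇒ χ)
  ¬∧-cases {φ} {χ} {ψ} = MP ∘ MP (tautology
    ((‵¬ P ‵⇒ R) ‵⇒ (‵¬ Q ‵⇒ R) ‵⇒ ‵¬ (P ‵∧ Q) ‵⇒ R)
    (φ ∷ ψ ∷ χ ∷ []))

  -- ⊥' unfolds to ¬ ¬ (var 0 ∧ ¬ var 0), hence the shape of these two schemata.

  ⊥'-elim : ⊢ (⊥' ⇒ φ)
  ⊥'-elim {φ} = tautology (‵¬ ‵¬ (P ‵∧ ‵¬ P) ‵⇒ Q) (var 0 ∷ φ ∷ [])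

  ⊥'-intro : ⊢ (φ ⇒ ¬' φ ⇒ ⊥')
  ⊥'-intro {φ} = tautology (P ‵⇒ ‵¬ P ‵⇒ ‵¬ ‵¬ (Q ‵∧ ‵¬ Q)) (φ ∷ var 0 ∷ [])

  ⇔-intro : ⊢ (φ ⇒ ψ) → ⊢ (ψ ⇒ φ) → ⊢ (φ ⇔ ψ)
  ⇔-intro {φ} {ψ} = MP ∘ MP (tautology
    (P ‵⇒ Q ‵⇒ P ‵∧ Q) ((φ ⇒ ψ) ∷ (ψ ⇒ φ) ∷ []))

  ⇔-to : ⊢ (φ ⇔ ψ) → ⊢ (φ ⇒ ψ)
  ⇔-to = MP ∧-elimˡ

  ⇔-from : ⊢ (φ ⇔ ψ) → ⊢ (ψ ⇒ φ)
  ⇔-from = MP ∧-elimʳ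

  ⇔-¬ : ⊢ (φ ⇔ ψ) → ⊢ (¬' φ ⇔ ¬' ψ)
  ⇔-¬ p = ⇔-intro (⇒-contrapose (⇔-from p)) (⇒-contrapose (⇔-to p))

  ⇔-trans : ⊢ (φ ⇔ ψ) → ⊢ (ψ ⇔ χ) → ⊢ (φ ⇔ χ)
  ⇔-trans p q = ⇔-intro (⇒-trans (⇔-to p) (⇔-to q)) (⇒-trans (⇔-from q) (⇔-from p))

  ∀-mono : ∀ a → ⊢ (φ ⇒ ψ) → ⊢ (∀' a φ ⇒ ∀' a ψ)
  ∀-mono {φ} {ψ} a p = MP (K∀ a φ ψ) (Nec∀ a p)

  ∀-mono₂ : ∀ a → ⊢ (φ ⇒ ψ ⇒ χ) → ⊢ (∀' a φ ⇒ ∀' a ψ ⇒ ∀' a χ)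
  ∀-mono₂ {ψ = ψ} {χ} a p = ⇒-trans (∀-mono a p) (K∀ a ψ χ)

  ∃-mono : ∀ a → ⊢ (φ ⇒ ψ) → ⊢ (∃' a φ ⇒ ∃' a ψ)
  ∃-mono a = ⇒-contrapose ∘ ∀-mono a ∘ ⇒-contrapose

  ∀-∧ : ∀ a → ⊢ (∀' a φ ∧' ∀' a ψ ⇒ ∀' a (φ ∧' ψ))
  ∀-∧ {φ} {ψ} a = ⇒-uncurry (∀-mono₂ a (tautology
    (P ‵⇒ Q ‵⇒ P ‵∧ Q) (φ ∷ ψ ∷ [])))

  ∀-∃-∧ : ∀ a → ⊢ (∀' a φ ∧' ∃' a ψ ⇒ ∃' a (φ ∧' ψ))
  ∀-∃-∧ {φ} {ψ} a = MP (tautology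
    ((P ‵⇒ Q ‵⇒ R) ‵⇒ P ‵∧ ‵¬ R ‵⇒ ‵¬ Q)
    (∀' a φ ∷ ∀' a (¬' (φ ∧' ψ)) ∷ ∀' a (¬' ψ) ∷ []))
    (∀-mono₂ a (tautology (P ‵⇒ ‵¬ (P ‵∧ Q) ‵⇒ ‵¬ Q) (φ ∷ ψ ∷ [])))

  -- ∀ₐ⊥ would yield both ∀ₐp and ∀ₐ¬p, hence p and ¬p.

  ∀-consistent : ∀ a → ⊢ (¬' ∀' a ⊥')
  ∀-consistent a = MP (MP (tautology
    ((P ‵⇒ Q) ‵⇒ (P ‵⇒ ‵¬ Q) ‵⇒ ‵¬ P) (∀' a ⊥' ∷ var 0 ∷ []))
    (⇒-trans (∀-mono a ⊥'-elim) (⇔-to (AP a 0))))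
    (⇒-trans (∀-mono a ⊥'-elim) (⇔-to (ANP a 0)))

  ∀⇒∃ : ∀ a → ⊢ (∀' a φ ⇒ ∃' a φ)
  ∀⇒∃ {φ} a = MP (MP (tautology
    ((P ‵⇒ Q ‵⇒ R) ‵⇒ ‵¬ R ‵⇒ P ‵⇒ ‵¬ Q)
    (∀' a φ ∷ ∀' a (¬' φ) ∷ ∀' a ⊥' ∷ []))
    (∀-mono₂ a ⊥'-intro))
    (∀-consistent a)

  ∀-introᴾ : ∀ a → IsProp φ → ⊢ (φ ⇒ ∀' a φ) × ⊢ (¬' φ ⇒ ∀' a (¬' φ))
  ∀-introᴾ a (var p) = ⇔-from (AP a p) , ⇔-from (ANP a p)
  ∀-introᴾ a (neg h) with ∀-introᴾ a h
  ... | φ↑ , ¬φ↑ = ¬φ↑ , ⇒-trans ¬¬-elim (⇒-trans φ↑ (∀-mono a ¬¬-intro))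
  ∀-introᴾ a (con h k) with ∀-introᴾ a h | ∀-introᴾ a k
  ... | φ↑ , ¬φ↑ | ψ↑ , ¬ψ↑ =
    ⇒-trans (∧-mono φ↑ ψ↑) (∀-∧ a) ,
    ¬∧-cases (⇒-trans ¬φ↑ (∀-mono a (⇒-contrapose ∧-elimˡ)))
             (⇒-trans ¬ψ↑ (∀-mono a (⇒-contrapose ∧-elimʳ)))

  ∀-elimᴾ : ∀ a → IsProp φ → ⊢ (∀' a φ ⇒ φ)
  ∀-elimᴾ {φ} a h = MP (MP (tautology
    ((‵¬ P ‵⇒ Q) ‵⇒ (R ‵⇒ ‵¬ Q) ‵⇒ R ‵⇒ P)
    (φ ∷ ∀' a (¬' φ) ∷ ∀' a φ ∷ []))
    (proj₂ (∀-introᴾ a h)))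
    (∀⇒∃ a)

  ∀⇔ᴾ : ∀ a → IsProp φ → ⊢ (∀' a φ ⇔ φ)
  ∀⇔ᴾ a h = ⇔-intro (∀-elimᴾ a h) (proj₁ (∀-introᴾ a h))

  ∃⇔ᴾ : ∀ a → IsProp φ → ⊢ (∃' a φ ⇔ φ)
  ∃⇔ᴾ a h = ⇔-trans (⇔-¬ (∀⇔ᴾ a (neg h))) (⇔-intro ¬¬-elim ¬¬-intro)

  ∧-∃⇔∃-∧ᴾ : ∀ a ψ → IsProp φ → ⊢ (φ ∧' ∃' a ψ ⇔ ∃' a (φ ∧' ψ))
  ∧-∃⇔∃-∧ᴾ a ψ h =
    ⇔-intro (⇒-trans (∧-mono (proj₁ (∀-introᴾ a h)) ⇒-refl) (∀-∃-∧ a))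
            (⇒-∧-intro (⇒-trans (∃-mono a ∧-elimˡ) (⇔-to (∃⇔ᴾ a h))) (∃-mono a ∧-elimʳ))

proposition11 : (n : ℕ) → let open Logic n in
    (a : Agent) (φ ψ : Form) → IsProp φ →
    (⊢ (∀' a φ ⇔ φ)) × (⊢ (∃' a φ ⇔ φ)) × (⊢ ((φ ∧' ∃' a ψ) ⇔ ∃' a (φ ∧' ψ)))
proposition11 n a φ ψ h = ∀⇔ᴾ a h , ∃⇔ᴾ a h , ∧-∃⇔∃-∧ᴾ a ψ h
  where open Derivations n
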